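{- Assume there exists an $(n,d,\delta)$-cyclic LPHS for random inputs. Then for every $0<\alpha(n)\le1$ and every $b\ge\omega(\log n)$, there exists an $(n,d',\delta')$-cyclic LPHS for worst-case inputs in $\mathsf{Good}^{\alpha}_n$, with $d'=O(d\cdot b)$ and $\delta'=\delta+n^2(1-\alpha)^b$.
   Context: Inputs are binary strings $x\in\{0,1\}^n$ indexed by $\mathbb{Z}_n$; $x\ll i$ denotes the cyclic left shift by $i$, $(x\ll i)[j]=x[j+i \bmod n]$; $\Delta$ denotes Hamming distance. An $(n,d,\delta)$-cyclic LPHS for random inputs is a function $h:\{0,1\}^n\to\mathbb{Z}_n$ computable with $d$ adaptive bit queries such that $\Pr_x[h(x)\neq h(x\ll 1)+1]\le\delta$ for uniform $x$. An input $x$ is $\alpha$-good if $\Delta(x\ll i,x)\ge\alpha n$ for every nonzero shift $0<i<n$; $\mathsf{Good}^\alpha_n$ is the set of $\alpha$-good inputs (it is closed under cyclic shifts). A family $\mathcal H$ of functions $h:\{0,1\}^n\to\mathbb{Z}_n$ is an $(n,d,\delta)$-cyclic LPHS for worst-case inputs in a set $X$ if each $h\in\mathcal H$ makes $d$ adaptive queries and for every $x$ in the closure $\{x\ll i: x\in X, 0\le i<n\}$, $\Pr_{h\in_R\mathcal H}[h(x)\neq h(x\ll1)+1]\le\delta$. -}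

module Defs where

open import Data.Bool using (Bool; true; false)
open import Data.Nat as ℕ using (ℕ; zero; suc; NonZero)
open import Data.Nat.DivMod using (_mod_)
open import Data.Nat.Properties using (m^n≢0)
open import Data.Nat.Logarithm using (⌊log₂_⌋)
open import Data.Fin using (Fin; toℕ)
open import Data.Fin.Properties using () renaming (_≟_ to _≟F_)
open import Data.Bool.Properties using () renaming (_≟_ to _≟B_)
open import Data.List using (List; []; _∷_; map; _++_; length; filter)
open import Data.Integer using (+_)
open import Data.Rational using (ℚ; _/_; _+_; _*_; _-_; _≤_; _<_; 0ℚ; 1ℚ)
open import Data.Product using (Σ; _×_; ∃-syntax)
open import Relation.Nullary using (¬_; Dec; yes; no)
open import Relation.Nullary using (¬?)
open import Relation.Binary.PropositionalEquality using (_≡_)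

-- Binary strings of length n, indexed by Fin n (identified with ℤ_n).
BitString : ℕ → Set
BitString n = Fin n → Bool

_≪_ : ∀ {n} .{{_ : NonZero n}} → BitString n → ℕ → BitString n
_≪_ {n} x i j = x ((toℕ j ℕ.+ i) mod n)

sucMod : ∀ {n} .{{_ : NonZero n}} → Fin n → Fin n
sucMod {n} a = (suc (toℕ a)) mod n

-- Adaptive query algorithms making at most d bit queries:
-- decision trees of depth ≤ d with outputs in ℤ_n.
data QTree (n : ℕ) : ℕ → Set where
  leaf  : ∀ {d} → Fin n → QTree n d
  query : ∀ {d} → Fin n → (ifFalse ifTrue : QTree n d) → QTree n (suc d)

eval : ∀ {n d} → QTree n d → BitString n → Fin n
eval (leaf o) x = o
eval (query i t₀ t₁) x with x i
... | false = eval t₀ x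
... | true  = eval t₁ x

allInputs : (n : ℕ) → List (BitString n)
allInputs zero = (λ ()) ∷ []
allInputs (suc n) =
  map (λ x → λ { Fin.zero → false ; (Fin.suc j) → x j }) (allInputs n)
  ++ map (λ x → λ { Fin.zero → true ; (Fin.suc j) → x j }) (allInputs n)

ℕ→ℚ : ℕ → ℚ
ℕ→ℚ k = (+ k) / 1

_^ℚ_ : ℚ → ℕ → ℚ
q ^ℚ zero = 1ℚ
q ^ℚ suc k = q * (q ^ℚ k)

prob : ℕ → (total : ℕ) → .{{_ : NonZero total}} → ℚ
prob k total = (+ k) / total

Fails : ∀ {n} .{{_ : NonZero n}} → (BitString n → Fin n) → BitString n → Set
Fails h x = ¬ (h x ≡ sucMod (h (x ≪ 1)))

fails? : ∀ {n} .{{_ : NonZero n}} (h : BitString n → Fin n) (x : BitString n) → Dec (Fails h x)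
fails? h x = ¬? (h x ≟F sucMod (h (x ≪ 1)))

IsRandomLPHS : (n d : ℕ) .{{_ : NonZero n}} → ℚ → QTree n d → Set
IsRandomLPHS n d δ t =
  prob (length (filter (fails? (eval t)) (allInputs n))) (2 ℕ.^ n) {{m^n≢0 2 n}} ≤ δ

RandomLPHS : (n d : ℕ) .{{_ : NonZero n}} → ℚ → Set
RandomLPHS n d δ = Σ (QTree n d) (IsRandomLPHS n d δ)

hamming : ∀ {n} → BitString n → BitString n → ℕ
hamming {n} x y = length (filter (λ j → ¬? (x j ≟B y j)) (Data.List.allFin n))
  where import Data.List

Good : (n : ℕ) .{{_ : NonZero n}} → ℚ → BitString n → Set
Good n α x = ∀ i → 0 ℕ.< i → i ℕ.< n → α * ℕ→ℚ n ≤ ℕ→ℚ (hamming (x ≪ i) x)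

ShiftClosure : ∀ {n} .{{_ : NonZero n}} → (BitString n → Set) → BitString n → Set
ShiftClosure {n} X y = ∃[ x ] ∃[ i ] (X x × i ℕ.< n × y ≡ x ≪ i)

-- A family H = (h_s)_{s ∈ Fin k}, k ≥ 1, of d-query functions, with h drawn
-- uniformly at random from H (uniform random seed s).
Family : (n d k : ℕ) → Set
Family n d k = Fin k → QTree n d

IsWorstCaseLPHS : (n d k : ℕ) .{{_ : NonZero n}} .{{nz : NonZero k}} →
                  ℚ → (BitString n → Set) → Family n d k → Set
IsWorstCaseLPHS n d k δ X H =
  ∀ x → ShiftClosure X x →
    prob (length (filter (λ s → fails? (eval (H s)) x) (Data.List.allFin k))) k ≤ δ
  where import Data.List

WorstCaseLPHS : (n d : ℕ) .{{_ : NonZero n}} → ℚ → (BitString n → Set) → Set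
WorstCaseLPHS n d δ X =
  Σ ℕ λ k → Σ (NonZero k) λ nz → Σ (Family n d k) (λ H → IsWorstCaseLPHS n d k {{nz = nz}} δ X H)

SuperLogarithmic : (ℕ → ℕ) → Set
SuperLogarithmic b = ∀ c → ∃[ N ] ∀ n → N ℕ.≤ n → c ℕ.* ⌊log₂ n ⌋ ℕ.≤ b n

module Submission where

-- A seed is a list r of b offsets in ℤ_n together with a random function T : {0,1}ᵇ → {0,1}; the
-- seeded hash runs the random-input LPHS on y[j] = T(x[j + r₁], …, x[j + r_b]). Every query to y
-- costs b queries to x, and y commutes with cyclic shifts of x. If the n windows (x[j + r_u])_u are
-- pairwise distinct, y is uniformly distributed over the choice of T, so the seeded hash fails
-- with probability at most δ. Two windows j ≠ j′ coincide with probability (A/n)ᵇ over r, where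
-- A = n − Δ(x ≪ (j′ − j), x) ≤ (1 − α)n for α-good x, and a union bound over the n² pairs adds
-- n²(1 − α)ᵇ.

module Sums where

  open import Data.Fin as Fin using (Fin; toℕ)
  open import Data.List
    using (List; []; _∷_; _++_; map; length; filter; tabulate; lookup; allFin; cartesianProductWith; cartesianProduct)
  open import Data.List.Properties using (map-tabulate; tabulate-lookup)
  open import Data.List.Membership.Propositional using (_∈_)
  open import Data.List.Relation.Unary.Any using (here; there)
  open import Data.Nat using (ℕ; zero; suc; _+_; _*_; _≤_; z≤n; s≤s)
  open import Data.Nat.Properties
  open import Algebra.Properties.CommutativeSemigroup +-commutativeSemigroup
    using () renaming (interchange to +-interchange)
  open import Data.Product using (_,_)
  open import Function using (_∘_; const)
  open import Relation.Nullary using (Dec; yes; no; ¬?)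
  open import Relation.Unary using (Decidable)
  open import Relation.Binary.PropositionalEquality

  𝟙 : {P : Set} → Dec P → ℕ
  𝟙 (yes _) = 1
  𝟙 (no _)  = 0

  𝟙≤1 : {P : Set} (p : Dec P) → 𝟙 p ≤ 1
  𝟙≤1 (yes _) = s≤s z≤n
  𝟙≤1 (no _)  = z≤n

  𝟙-cong : {P Q : Set} (p : Dec P) (q : Dec Q) → (P → Q) → (Q → P) → 𝟙 p ≡ 𝟙 q
  𝟙-cong (yes _) (yes _) _   _   = refl
  𝟙-cong (yes p) (no ¬q) p→q _   with () ← ¬q (p→q p)
  𝟙-cong (no ¬p) (yes q) _   q→p with () ← ¬p (q→p q)
  𝟙-cong (no _)  (no _)  _   _   = refl

  𝟙+𝟙¬≡1 : {P : Set} (p : Dec P) → 𝟙 p + 𝟙 (¬? p) ≡ 1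
  𝟙+𝟙¬≡1 (yes _) = refl
  𝟙+𝟙¬≡1 (no _)  = refl

  private variable
    A B : Set

  ∑ : List A → (A → ℕ) → ℕ
  ∑ []       f = 0
  ∑ (a ∷ as) f = f a + ∑ as f

  ∑-cong : ∀ xs {f g : A → ℕ} → (∀ a → f a ≡ g a) → ∑ xs f ≡ ∑ xs g
  ∑-cong []       f≗g = refl
  ∑-cong (a ∷ as) f≗g = cong₂ _+_ (f≗g a) (∑-cong as f≗g)

  ∑-mono-≤ : ∀ xs {f g : A → ℕ} → (∀ a → f a ≤ g a) → ∑ xs f ≤ ∑ xs g
  ∑-mono-≤ []       f≤g = z≤n
  ∑-mono-≤ (a ∷ as) f≤g = +-mono-≤ (f≤g a) (∑-mono-≤ as f≤g)

  ∑-++ : ∀ xs ys (f : A → ℕ) → ∑ (xs ++ ys) f ≡ ∑ xs f + ∑ ys f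
  ∑-++ []       ys f = refl
  ∑-++ (a ∷ as) ys f = trans (cong (f a +_) (∑-++ as ys f)) (sym (+-assoc (f a) _ _))

  ∑-distrib-+ : ∀ xs (f g : A → ℕ) → ∑ xs (λ a → f a + g a) ≡ ∑ xs f + ∑ xs g
  ∑-distrib-+ []       f g = refl
  ∑-distrib-+ (a ∷ as) f g =
    trans (cong (f a + g a +_) (∑-distrib-+ as f g)) (+-interchange (f a) (g a) (∑ as f) (∑ as g))

  ∑-*ˡ : ∀ xs c (f : A → ℕ) → ∑ xs (λ a → c * f a) ≡ c * ∑ xs f
  ∑-*ˡ []       c f = sym (*-zeroʳ c)
  ∑-*ˡ (a ∷ as) c f = trans (cong (c * f a +_) (∑-*ˡ as c f)) (sym (*-distribˡ-+ c (f a) _))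

  ∑-*ʳ : ∀ xs c (f : A → ℕ) → ∑ xs (λ a → f a * c) ≡ ∑ xs f * c
  ∑-*ʳ xs c f = trans (∑-cong xs (λ a → *-comm (f a) c)) (trans (∑-*ˡ xs c f) (*-comm c _))

  ∑-const : ∀ (xs : List A) c → ∑ xs (const c) ≡ length xs * c
  ∑-const []       c = refl
  ∑-const (a ∷ as) c = cong (c +_) (∑-const as c)

  length≡∑1 : (xs : List A) → length xs ≡ ∑ xs (const 1)
  length≡∑1 xs = trans (sym (*-identityʳ (length xs))) (sym (∑-const xs 1))

  ∑-comm : ∀ xs (ys : List B) (f : A → B → ℕ) →
           ∑ xs (λ a → ∑ ys (f a)) ≡ ∑ ys (λ b → ∑ xs (λ a → f a b))
  ∑-comm []       ys f = sym (trans (∑-const ys 0) (*-zeroʳ (length ys)))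
  ∑-comm (a ∷ as) ys f =
    trans (cong (∑ ys (f a) +_) (∑-comm as ys f)) (sym (∑-distrib-+ ys (f a) _))

  ∑-map : ∀ (g : B → A) xs (f : A → ℕ) → ∑ (map g xs) f ≡ ∑ xs (f ∘ g)
  ∑-map g []       f = refl
  ∑-map g (b ∷ bs) f = cong (f (g b) +_) (∑-map g bs f)

  ∑-lookup : ∀ xs (f : A → ℕ) → ∑ (allFin (length xs)) (f ∘ lookup xs) ≡ ∑ xs f
  ∑-lookup xs f = begin
    ∑ (allFin (length xs)) (f ∘ lookup xs)     ≡⟨ ∑-map (lookup xs) (allFin (length xs)) f ⟨
    ∑ (map (lookup xs) (allFin (length xs))) f ≡⟨ cong (λ ys → ∑ ys f) (map-tabulate (λ i → i) (lookup xs)) ⟩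
    ∑ (tabulate (lookup xs)) f                 ≡⟨ cong (λ ys → ∑ ys f) (tabulate-lookup xs) ⟩
    ∑ xs f                                     ∎
    where open ≡-Reasoning

  ∑≡0⇒≡0 : ∀ {xs} (f : A → ℕ) → ∑ xs f ≡ 0 → ∀ {a} → a ∈ xs → f a ≡ 0
  ∑≡0⇒≡0 {xs = a ∷ as} f sum≡0 (here refl)  = m+n≡0⇒m≡0 (f a) sum≡0
  ∑≡0⇒≡0 {xs = a ∷ as} f sum≡0 (there a∈as) = ∑≡0⇒≡0 f (m+n≡0⇒n≡0 (f a) sum≡0) a∈as

  length-filter≡∑𝟙 : ∀ {P : A → Set} (P? : Decidable P) xs → length (filter P? xs) ≡ ∑ xs (𝟙 ∘ P?)
  length-filter≡∑𝟙 P? []       = refl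
  length-filter≡∑𝟙 P? (a ∷ as) with P? a
  ... | yes _ = cong suc (length-filter≡∑𝟙 P? as)
  ... | no  _ = length-filter≡∑𝟙 P? as

  ∑-cartesianProductWith : ∀ {C : Set} (f : A → B → C) xs ys (h : C → ℕ) →
                           ∑ (cartesianProductWith f xs ys) h ≡ ∑ xs (λ a → ∑ ys (h ∘ f a))
  ∑-cartesianProductWith f []       ys h = refl
  ∑-cartesianProductWith f (a ∷ as) ys h =
    trans (∑-++ (map (f a) ys) _ h) (cong₂ _+_ (∑-map (f a) ys h) (∑-cartesianProductWith f as ys h))

  ∑-cartesianProduct : ∀ xs ys (f : A → ℕ) (g : B → ℕ) →
                       ∑ (cartesianProduct xs ys) (λ (a , b) → f a * g b) ≡ ∑ xs f * ∑ ys g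
  ∑-cartesianProduct xs ys f g = begin
    ∑ (cartesianProduct xs ys) (λ (a , b) → f a * g b) ≡⟨ ∑-cartesianProductWith _,_ xs ys _ ⟩
    ∑ xs (λ a → ∑ ys (λ b → f a * g b))                ≡⟨ ∑-cong xs (λ a → ∑-*ˡ ys (f a) g) ⟩
    ∑ xs (λ a → f a * ∑ ys g)                          ≡⟨ ∑-*ʳ xs (∑ ys g) f ⟩
    ∑ xs f * ∑ ys g                                    ∎
    where open ≡-Reasoning

  ∑< : ℕ → (ℕ → ℕ) → ℕ
  ∑< zero    h = 0
  ∑< (suc m) h = h 0 + ∑< m (h ∘ suc)

  ∑<-cong : ∀ m {g h : ℕ → ℕ} → (∀ k → g k ≡ h k) → ∑< m g ≡ ∑< m h
  ∑<-cong zero    g≗h = refl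
  ∑<-cong (suc m) g≗h = cong₂ _+_ (g≗h 0) (∑<-cong m (g≗h ∘ suc))

  ∑<-suc : ∀ m h → ∑< (suc m) h ≡ ∑< m h + h m
  ∑<-suc zero    h = +-comm (h 0) 0
  ∑<-suc (suc m) h = trans (cong (h 0 +_) (∑<-suc m (h ∘ suc))) (sym (+-assoc (h 0) _ _))

  ∑<-rotate : ∀ m (h : ℕ → ℕ) → (∀ k → h (k + m) ≡ h k) → ∀ c → ∑< m (λ k → h (k + c)) ≡ ∑< m h
  ∑<-rotate m h periodic zero    = ∑<-cong m (λ k → cong h (+-identityʳ k))
  ∑<-rotate m h periodic (suc c) = begin
    ∑< m (λ k → h (k + suc c))     ≡⟨ ∑<-cong m (λ k → cong h (+-suc k c)) ⟩
    ∑< m (λ k → h (suc k + c))     ≡⟨ +-cancelˡ-≡ (h c) _ _ (trans (∑<-suc m (λ k → h (k + c))) wrap) ⟩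
    ∑< m (λ k → h (k + c))         ≡⟨ ∑<-rotate m h periodic c ⟩
    ∑< m h                         ∎
    where
    open ≡-Reasoning
    wrap : ∑< m (λ k → h (k + c)) + h (m + c) ≡ h c + ∑< m (λ k → h (k + c))
    wrap = trans (cong (∑< m (λ k → h (k + c)) +_) (trans (cong h (+-comm m c)) (periodic c))) (+-comm _ (h c))

  ∑-allFin-toℕ : ∀ m (h : ℕ → ℕ) → ∑ (allFin m) (h ∘ toℕ) ≡ ∑< m h
  ∑-allFin-toℕ zero    h = refl
  ∑-allFin-toℕ (suc m) h =
    cong (h 0 +_) (begin
      ∑ (tabulate {n = m} Fin.suc) (h ∘ toℕ)
        ≡⟨ cong (λ xs → ∑ xs (h ∘ toℕ)) (map-tabulate {n = m} (λ i → i) Fin.suc) ⟨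
      ∑ (map Fin.suc (allFin m)) (h ∘ toℕ)   ≡⟨ ∑-map Fin.suc (allFin m) (h ∘ toℕ) ⟩
      ∑ (allFin m) (h ∘ suc ∘ toℕ)           ≡⟨ ∑-allFin-toℕ m (h ∘ suc) ⟩
      ∑< m (h ∘ suc)                          ∎)
    where open ≡-Reasoning

module RationalBounds where

  open import Defs
  open Sums
  open import Data.Integer as ℤ using (+_)
  import Data.Integer.Properties as ℤ
  open import Data.List using (List; []; _∷_; length)
  open import Data.Nat as ℕ using (ℕ; zero; suc; NonZero)
  open import Data.Nat.Coprimality using (1-coprimeTo; sym)
  import Data.Nat.Properties as ℕ
  open import Data.Rational using (mkℚ; _+_; _*_; _-_; -_; _≤_; 0ℚ; 1ℚ; *≤*; Positive; nonNegative)
  open import Data.Rational.Properties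
  open import Data.Rational.Solver using (module +-*-Solver)
  open import Data.Rational.Unnormalised as ℚᵘ using (mkℚᵘ; *≡*)
  import Data.Rational.Unnormalised.Properties as ℚᵘ
  open import Relation.Binary.PropositionalEquality using (_≡_; refl; cong; cong₂; subst; subst₂)
    renaming (sym to ≡-sym; trans to ≡-trans)

  ℕ→ℚ≡mkℚ : ∀ a → ℕ→ℚ a ≡ mkℚ (+ a) 0 (sym (1-coprimeTo a))
  ℕ→ℚ≡mkℚ a = normalize-coprime _

  ℕ→ℚ-+ : ∀ a b → ℕ→ℚ (a ℕ.+ b) ≡ ℕ→ℚ a + ℕ→ℚ b
  ℕ→ℚ-+ a b rewrite ℕ→ℚ≡mkℚ a | ℕ→ℚ≡mkℚ b =
    ≡-sym (/-cong (≡-trans (cong₂ ℤ._+_ (ℤ.*-identityʳ (+ a)) (ℤ.*-identityʳ (+ b)))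
                           (≡-sym (ℤ.pos-+ a b))) refl)

  ℕ→ℚ-* : ∀ a b → ℕ→ℚ (a ℕ.* b) ≡ ℕ→ℚ a * ℕ→ℚ b
  ℕ→ℚ-* a b rewrite ℕ→ℚ≡mkℚ a | ℕ→ℚ≡mkℚ b = /-cong (ℤ.pos-* a b) refl

  ℕ→ℚ-^ : ∀ a k → ℕ→ℚ (a ℕ.^ k) ≡ ℕ→ℚ a ^ℚ k
  ℕ→ℚ-^ a zero    = refl
  ℕ→ℚ-^ a (suc k) = ≡-trans (ℕ→ℚ-* a (a ℕ.^ k)) (cong (ℕ→ℚ a *_) (ℕ→ℚ-^ a k))

  ℕ→ℚ-mono-≤ : ∀ {a b} → a ℕ.≤ b → ℕ→ℚ a ≤ ℕ→ℚ b
  ℕ→ℚ-mono-≤ {a} {b} a≤b rewrite ℕ→ℚ≡mkℚ a | ℕ→ℚ≡mkℚ b =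
    *≤* (subst₂ ℤ._≤_ (≡-sym (ℤ.*-identityʳ (+ a))) (≡-sym (ℤ.*-identityʳ (+ b))) (ℤ.+≤+ a≤b))

  0≤ℕ→ℚ : ∀ a → 0ℚ ≤ ℕ→ℚ a
  0≤ℕ→ℚ a = ℕ→ℚ-mono-≤ {0} {a} ℕ.z≤n

  ℕ→ℚ-pos : ∀ a .{{_ : NonZero a}} → Positive (ℕ→ℚ a)
  ℕ→ℚ-pos (suc a) rewrite ℕ→ℚ≡mkℚ (suc a) = _

  *-monoʳ-≤-0≤ : ∀ {p q r} → 0ℚ ≤ r → p ≤ q → p * r ≤ q * r
  *-monoʳ-≤-0≤ {r = r} 0≤r = *-monoʳ-≤-nonNeg r {{nonNegative 0≤r}}

  *-monoˡ-≤-0≤ : ∀ {p q r} → 0ℚ ≤ r → p ≤ q → r * p ≤ r * q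
  *-monoˡ-≤-0≤ {r = r} 0≤r = *-monoˡ-≤-nonNeg r {{nonNegative 0≤r}}

  0≤* : ∀ {p q} → 0ℚ ≤ p → 0ℚ ≤ q → 0ℚ ≤ p * q
  0≤* {p} 0≤p 0≤q = ≤-trans (≤-reflexive (≡-sym (*-zeroʳ p))) (*-monoˡ-≤-0≤ 0≤p 0≤q)

  p≤q⇒0≤q-p : ∀ {p q} → p ≤ q → 0ℚ ≤ q - p
  p≤q⇒0≤q-p {p} p≤q = ≤-trans (≤-reflexive (≡-sym (+-inverseʳ p))) (+-monoˡ-≤ (- p) p≤q)

  0≤^ℚ : ∀ {p} k → 0ℚ ≤ p → 0ℚ ≤ p ^ℚ k
  0≤^ℚ zero    0≤p = 0≤ℕ→ℚ 1
  0≤^ℚ (suc k) 0≤p = 0≤* 0≤p (0≤^ℚ k 0≤p)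

  ^ℚ-mono-≤ : ∀ {p q} k → 0ℚ ≤ p → p ≤ q → p ^ℚ k ≤ q ^ℚ k
  ^ℚ-mono-≤ zero    0≤p p≤q = ≤-refl
  ^ℚ-mono-≤ (suc k) 0≤p p≤q =
    ≤-trans (*-monoʳ-≤-0≤ (0≤^ℚ k 0≤p) p≤q) (*-monoˡ-≤-0≤ (≤-trans 0≤p p≤q) (^ℚ-mono-≤ k 0≤p p≤q))

  ^ℚ-distrib-* : ∀ p q k → (p * q) ^ℚ k ≡ p ^ℚ k * q ^ℚ k
  ^ℚ-distrib-* p q zero    = refl
  ^ℚ-distrib-* p q (suc k) rewrite ^ℚ-distrib-* p q k =
    solve 4 (λ p q a b → (p :* q) :* (a :* b) := (p :* a) :* (q :* b)) refl p q (p ^ℚ k) (q ^ℚ k)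
    where open +-*-Solver

  prob*total≡count : ∀ a c .{{_ : NonZero c}} → prob a c * ℕ→ℚ c ≡ ℕ→ℚ a
  prob*total≡count a (suc c) = toℚᵘ-injective (ℚᵘ.≃-trans (toℚᵘ-homo-* (prob a (suc c)) (ℕ→ℚ (suc c)))
    (ℚᵘ.≃-trans (ℚᵘ.*-cong (toℚᵘ-fromℚᵘ (mkℚᵘ (+ a) c)) (toℚᵘ-fromℚᵘ (mkℚᵘ (+ suc c) 0)))
    (ℚᵘ.≃-trans cancel (ℚᵘ.≃-sym (toℚᵘ-fromℚᵘ (mkℚᵘ (+ a) 0))))))
    where
    cancel : mkℚᵘ (+ a) c ℚᵘ.* mkℚᵘ (+ suc c) 0 ℚᵘ.≃ mkℚᵘ (+ a) 0
    cancel = *≡* (≡-trans (ℤ.*-identityʳ (+ a ℤ.* + suc c))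
                          (cong (λ z → + a ℤ.* + suc z) (≡-sym (ℕ.*-identityʳ c))))

  prob≤⇒count≤ : ∀ a c .{{_ : NonZero c}} {q} → prob a c ≤ q → ℕ→ℚ a ≤ q * ℕ→ℚ c
  prob≤⇒count≤ a c {q} prob≤q =
    subst (_≤ q * ℕ→ℚ c) (prob*total≡count a c) (*-monoʳ-≤-0≤ (0≤ℕ→ℚ c) prob≤q)

  count≤⇒prob≤ : ∀ a c .{{_ : NonZero c}} {q} → ℕ→ℚ a ≤ q * ℕ→ℚ c → prob a c ≤ q
  count≤⇒prob≤ a c {q} a≤qc =
    *-cancelʳ-≤-pos (ℕ→ℚ c) {{ℕ→ℚ-pos c}} (subst (_≤ q * ℕ→ℚ c) (≡-sym (prob*total≡count a c)) a≤qc)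

  ℕ→ℚ-∑-≤ : ∀ {A : Set} (xs : List A) (f : A → ℕ) {B} →
            (∀ a → ℕ→ℚ (f a) ≤ B) → ℕ→ℚ (∑ xs f) ≤ ℕ→ℚ (length xs) * B
  ℕ→ℚ-∑-≤ []       f {B} f≤B = ≤-reflexive (≡-sym (*-zeroˡ B))
  ℕ→ℚ-∑-≤ (a ∷ as) f {B} f≤B = begin
    ℕ→ℚ (f a ℕ.+ ∑ as f)                ≡⟨ ℕ→ℚ-+ (f a) (∑ as f) ⟩
    ℕ→ℚ (f a) + ℕ→ℚ (∑ as f)            ≤⟨ +-mono-≤ (f≤B a) (ℕ→ℚ-∑-≤ as f f≤B) ⟩
    B + ℕ→ℚ (length as) * B
      ≡⟨ solve 2 (λ B l → B :+ l :* B := (con 1ℚ :+ l) :* B) refl B (ℕ→ℚ (length as)) ⟩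
    (1ℚ + ℕ→ℚ (length as)) * B          ≡⟨ cong (_* B) (ℕ→ℚ-+ 1 (length as)) ⟨
    ℕ→ℚ (length (a ∷ as)) * B           ∎
    where
    open ≤-Reasoning
    open +-*-Solver

  m+n≡k⇒αk≤n⇒m≤[1-α]k : ∀ m n k α → m ℕ.+ n ≡ k → α * ℕ→ℚ k ≤ ℕ→ℚ n →
                        ℕ→ℚ m ≤ (1ℚ - α) * ℕ→ℚ k
  m+n≡k⇒αk≤n⇒m≤[1-α]k m n k α m+n≡k αk≤n = begin
    ℕ→ℚ m                     ≡⟨ solve 2 (λ m n → m := (m :+ n) :- n) refl (ℕ→ℚ m) (ℕ→ℚ n) ⟩
    (ℕ→ℚ m + ℕ→ℚ n) - ℕ→ℚ n   ≡⟨ cong (_- ℕ→ℚ n) (≡-trans (≡-sym (ℕ→ℚ-+ m n)) (cong ℕ→ℚ m+n≡k)) ⟩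
    ℕ→ℚ k - ℕ→ℚ n             ≤⟨ +-monoʳ-≤ (ℕ→ℚ k) (neg-antimono-≤ αk≤n) ⟩
    ℕ→ℚ k - α * ℕ→ℚ k         ≡⟨ solve 2 (λ k α → k :- α :* k := (con 1ℚ :- α) :* k) refl (ℕ→ℚ k) α ⟩
    (1ℚ - α) * ℕ→ℚ k          ∎
    where
    open ≤-Reasoning
    open +-*-Solver

module RandomTables where

  open import Defs
  open Sums
  open import Data.Bool using (Bool; true; false)
  open import Data.Bool.Properties using (_≟_)
  open import Data.Empty using (⊥-elim)
  open import Data.Fin using (Fin; zero; suc)
  open import Data.List using (List; []; _∷_; _++_; _∷ʳ_; map; length; tabulate; cartesianProduct)
  open import Data.List.Properties using (length-++; map-++; ++-assoc; ++-identityʳ)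
  open import Data.List.Relation.Unary.All using (All; []; _∷_)
  open import Data.List.Relation.Unary.AllPairs using ([]; _∷_)
  open import Data.List.Relation.Unary.Unique.Propositional using (Unique)
  open import Data.Nat using (ℕ; zero; suc; _+_; _*_; _^_)
  open import Data.Nat.Properties hiding (_≟_)
  open import Algebra.Properties.CommutativeSemigroup *-commutativeSemigroup
    using (x∙yz≈y∙xz; xy∙z≈xz∙y) renaming (interchange to *-interchange)
  open import Data.Product using (_×_; _,_; proj₁)
  open import Data.Vec using (Vec; []; _∷_)
  open import Data.Vec.Functional using () renaming (_∷_ to _∷ᶠ_)
  open import Function using (_∘_)
  open import Relation.Nullary using (yes; no)
  open import Relation.Binary.PropositionalEquality

  private variable
    b m : ℕ

  -- Truth tables of functions {0,1}ᵇ → {0,1}, as complete binary trees of depth b.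
  Table : ℕ → Set
  Table zero    = Bool
  Table (suc b) = Table b × Table b

  _!_ : Table b → Vec Bool b → Bool
  _!_ {zero} v         []          = v
  (T₀ , T₁)  ! (false ∷ w) = T₀ ! w
  (T₀ , T₁)  ! (true  ∷ w) = T₁ ! w

  allTables : ∀ b → List (Table b)
  allTables zero    = false ∷ true ∷ []
  allTables (suc b) = cartesianProduct (allTables b) (allTables b)

  Constraint : ℕ → Set
  Constraint b = Vec Bool b × Bool

  keys : List (Constraint b) → List (Vec Bool b)
  keys = map proj₁

  satisfies : Table b → List (Constraint b) → ℕ
  satisfies T []             = 1
  satisfies T ((w , v) ∷ cs) = 𝟙 (T ! w ≟ v) * satisfies T cs

  satisfies-∷ʳ : ∀ (T : Table b) cs w v →
                 satisfies T (cs ∷ʳ (w , v)) ≡ satisfies T cs * 𝟙 (T ! w ≟ v)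
  satisfies-∷ʳ T []              w v = trans (*-identityʳ _) (sym (*-identityˡ _))
  satisfies-∷ʳ T ((w′ , v′) ∷ cs) w v =
    trans (cong (𝟙 (T ! w′ ≟ v′) *_) (satisfies-∷ʳ T cs w v)) (sym (*-assoc (𝟙 (T ! w′ ≟ v′)) _ _))

  restrict : Bool → List (Constraint (suc b)) → List (Constraint b)
  restrict v []                  = []
  restrict v ((u ∷ w , o) ∷ cs) with u ≟ v
  ... | yes _ = (w , o) ∷ restrict v cs
  ... | no  _ = restrict v cs

  satisfies-split : ∀ (T₀ T₁ : Table b) cs →
                    satisfies (T₀ , T₁) cs ≡ satisfies T₀ (restrict false cs) * satisfies T₁ (restrict true cs)
  satisfies-split T₀ T₁ [] = refl
  satisfies-split T₀ T₁ ((false ∷ w , o) ∷ cs) =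
    trans (cong (𝟙 (T₀ ! w ≟ o) *_) (satisfies-split T₀ T₁ cs)) (sym (*-assoc (𝟙 (T₀ ! w ≟ o)) _ _))
  satisfies-split T₀ T₁ ((true  ∷ w , o) ∷ cs) =
    trans (cong (𝟙 (T₁ ! w ≟ o) *_) (satisfies-split T₀ T₁ cs))
          (x∙yz≈y∙xz (𝟙 (T₁ ! w ≟ o)) (satisfies T₀ (restrict false cs)) _)

  length-restrict : (cs : List (Constraint (suc b))) →
                    length cs ≡ length (restrict false cs) + length (restrict true cs)
  length-restrict []                      = refl
  length-restrict ((false ∷ w , o) ∷ cs) = cong suc (length-restrict cs)
  length-restrict ((true  ∷ w , o) ∷ cs) = trans (cong suc (length-restrict cs)) (sym (+-suc _ _))

  restrict-fresh : ∀ {u v} {w : Vec Bool b} (cs : List (Constraint (suc b))) → u ≡ v →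
                   All (u ∷ w ≢_) (keys cs) → All (w ≢_) (keys (restrict v cs))
  restrict-fresh [] u≡v [] = []
  restrict-fresh {v = v} ((u′ ∷ w′ , o) ∷ cs) u≡v (≢w′ ∷ fresh) with u′ ≟ v
  ... | yes u′≡v =
    (λ w≡w′ → ≢w′ (cong₂ _∷_ (trans u≡v (sym u′≡v)) w≡w′)) ∷ restrict-fresh cs u≡v fresh
  ... | no  _    = restrict-fresh cs u≡v fresh

  restrict-unique : ∀ v (cs : List (Constraint (suc b))) →
                    Unique (keys cs) → Unique (keys (restrict v cs))
  restrict-unique v [] [] = []
  restrict-unique v ((u ∷ w , o) ∷ cs) (fresh ∷ unique) with u ≟ v
  ... | yes u≡v = restrict-fresh cs u≡v fresh ∷ restrict-unique v cs unique
  ... | no  _   = restrict-unique v cs unique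

  ∑-satisfies : ∀ b (cs : List (Constraint b)) → Unique (keys cs) →
                ∑ (allTables b) (λ T → satisfies T cs) * 2 ^ length cs ≡ 2 ^ 2 ^ b
  ∑-satisfies zero [] _                   = refl
  ∑-satisfies zero (([] , false) ∷ []) _  = refl
  ∑-satisfies zero (([] , true)  ∷ []) _  = refl
  ∑-satisfies zero (([] , _) ∷ ([] , _) ∷ _) ((≢[] ∷ _) ∷ _) = ⊥-elim (≢[] refl)
  ∑-satisfies (suc b) cs unique = begin
    ∑ (cartesianProduct (allTables b) (allTables b)) (λ T → satisfies T cs) * 2 ^ length cs
      ≡⟨ cong₂ _*_ (∑-cong (cartesianProduct (allTables b) (allTables b))
                           (λ (T₀ , T₁) → satisfies-split T₀ T₁ cs))
                   (cong (2 ^_) (length-restrict cs)) ⟩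
    ∑ (cartesianProduct (allTables b) (allTables b)) (λ (T₀ , T₁) → satisfies T₀ cs₀ * satisfies T₁ cs₁)
      * 2 ^ (length cs₀ + length cs₁)
      ≡⟨ cong₂ _*_ (∑-cartesianProduct (allTables b) (allTables b) _ _) (^-distribˡ-+-* 2 (length cs₀) _) ⟩
    (S₀ * S₁) * (2 ^ length cs₀ * 2 ^ length cs₁)
      ≡⟨ *-interchange S₀ S₁ _ _ ⟩
    (S₀ * 2 ^ length cs₀) * (S₁ * 2 ^ length cs₁)
      ≡⟨ cong₂ _*_ (∑-satisfies b cs₀ (restrict-unique false cs unique))
                   (∑-satisfies b cs₁ (restrict-unique true cs unique)) ⟩
    2 ^ 2 ^ b * 2 ^ 2 ^ b
      ≡⟨ ^-distribˡ-+-* 2 (2 ^ b) (2 ^ b) ⟨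
    2 ^ (2 ^ b + 2 ^ b)
      ≡⟨ cong (λ e → 2 ^ (2 ^ b + e)) (+-identityʳ (2 ^ b)) ⟨
    2 ^ 2 ^ suc b ∎
    where
    open ≡-Reasoning
    cs₀ : List (Constraint b)
    cs₀ = restrict false cs
    cs₁ : List (Constraint b)
    cs₁ = restrict true cs
    S₀ : ℕ
    S₀ = ∑ (allTables b) (λ T → satisfies T cs₀)
    S₁ : ℕ
    S₁ = ∑ (allTables b) (λ T → satisfies T cs₁)

  length-allTables : ∀ b → length (allTables b) ≡ 2 ^ 2 ^ b
  length-allTables b =
    trans (length≡∑1 (allTables b)) (trans (sym (*-identityʳ _)) (∑-satisfies b [] []))

  bit-split : ∀ a S (Q : Bool → ℕ) →
              S * Q a ≡ S * 𝟙 (a ≟ false) * Q false + S * 𝟙 (a ≟ true) * Q true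
  bit-split false S Q = trans (sym (+-identityʳ _))
    (cong₂ _+_ (cong (_* Q false) (sym (*-identityʳ S))) (cong (_* Q true) (sym (*-zeroʳ S))))
  bit-split true  S Q =
    cong₂ _+_ (cong (_* Q false) (sym (*-zeroʳ S))) (cong (_* Q true) (sym (*-identityʳ S)))

  Extensional : (BitString m → ℕ) → Set
  Extensional P = ∀ {y y′} → (∀ j → y j ≡ y′ j) → P y ≡ P y′

  ∑-allInputs-suc : ∀ m (P : BitString (suc m) → ℕ) → Extensional P →
    ∑ (allInputs (suc m)) P
      ≡ ∑ (allInputs m) (λ y → P (false ∷ᶠ y)) + ∑ (allInputs m) (λ y → P (true ∷ᶠ y))
  ∑-allInputs-suc m P ext = trans (∑-++ (map _ (allInputs m)) (map _ (allInputs m)) P) (cong₂ _+_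
    (trans (∑-map _ (allInputs m) P) (∑-cong (allInputs m) λ y → ext λ { zero → refl ; (suc j) → refl }))
    (trans (∑-map _ (allInputs m) P) (∑-cong (allInputs m) λ y → ext λ { zero → refl ; (suc j) → refl })))

  -- The constraints cs record the points already read; they make the induction on m go through.
  ∑-tables-uniform : ∀ m (ws : Fin m → Vec Bool b) (cs : List (Constraint b)) (P : BitString m → ℕ) →
    Extensional P → Unique (keys cs ++ tabulate ws) →
    ∑ (allTables b) (λ T → satisfies T cs * P (λ j → T ! ws j)) * 2 ^ (length cs + m)
      ≡ 2 ^ 2 ^ b * ∑ (allInputs m) P
  ∑-tables-uniform {b} zero ws cs P ext unique = begin
    ∑ (allTables b) (λ T → satisfies T cs * P (λ j → T ! ws j)) * 2 ^ (length cs + 0)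
      ≡⟨ cong₂ _*_ (∑-cong (allTables b) (λ T → cong (satisfies T cs *_) (ext λ ())))
                   (cong (2 ^_) (+-identityʳ (length cs))) ⟩
    ∑ (allTables b) (λ T → satisfies T cs * P y₀) * 2 ^ length cs
      ≡⟨ cong (_* 2 ^ length cs) (∑-*ʳ (allTables b) (P y₀) _) ⟩
    S * P y₀ * 2 ^ length cs
      ≡⟨ xy∙z≈xz∙y S (P y₀) _ ⟩
    S * 2 ^ length cs * P y₀
      ≡⟨ cong (_* P y₀) (∑-satisfies b cs (subst Unique (++-identityʳ (keys cs)) unique)) ⟩
    2 ^ 2 ^ b * P y₀
      ≡⟨ cong (2 ^ 2 ^ b *_) (trans (ext λ ()) (sym (+-identityʳ _))) ⟩
    2 ^ 2 ^ b * ∑ (allInputs 0) P ∎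
    where
    open ≡-Reasoning
    y₀ : BitString 0
    y₀ ()
    S : ℕ
    S = ∑ (allTables b) (λ T → satisfies T cs)
  ∑-tables-uniform {b} (suc m) ws cs P ext unique = begin
    ∑ (allTables b) (λ T → satisfies T cs * P (λ j → T ! ws j)) * 2 ^ (length cs + suc m)
      ≡⟨ cong (_* 2 ^ (length cs + suc m)) (trans (∑-cong (allTables b) split) (∑-distrib-+ (allTables b) _ _)) ⟩
    (∑ (allTables b) (fixing false) + ∑ (allTables b) (fixing true)) * 2 ^ (length cs + suc m)
      ≡⟨ *-distribʳ-+ (2 ^ (length cs + suc m)) (∑ (allTables b) (fixing false)) _ ⟩
    ∑ (allTables b) (fixing false) * 2 ^ (length cs + suc m)
      + ∑ (allTables b) (fixing true) * 2 ^ (length cs + suc m)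
      ≡⟨ cong₂ _+_ (induction false) (induction true) ⟩
    2 ^ 2 ^ b * ∑ (allInputs m) (λ y → P (false ∷ᶠ y)) + 2 ^ 2 ^ b * ∑ (allInputs m) (λ y → P (true ∷ᶠ y))
      ≡⟨ *-distribˡ-+ (2 ^ 2 ^ b) _ _ ⟨
    2 ^ 2 ^ b * (∑ (allInputs m) (λ y → P (false ∷ᶠ y)) + ∑ (allInputs m) (λ y → P (true ∷ᶠ y)))
      ≡⟨ cong (2 ^ 2 ^ b *_) (∑-allInputs-suc m P ext) ⟨
    2 ^ 2 ^ b * ∑ (allInputs (suc m)) P ∎
    where
    open ≡-Reasoning
    fixing : Bool → Table b → ℕ
    fixing v T = satisfies T (cs ∷ʳ (ws zero , v)) * P (v ∷ᶠ (λ j → T ! ws (suc j)))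

    split : ∀ T → satisfies T cs * P (λ j → T ! ws j) ≡ fixing false T + fixing true T
    split T = begin
      satisfies T cs * P (λ j → T ! ws j)
        ≡⟨ cong (satisfies T cs *_) (ext λ { zero → refl ; (suc j) → refl }) ⟩
      satisfies T cs * Q (T ! ws zero)
        ≡⟨ bit-split (T ! ws zero) (satisfies T cs) Q ⟩
      satisfies T cs * 𝟙 (T ! ws zero ≟ false) * Q false + satisfies T cs * 𝟙 (T ! ws zero ≟ true) * Q true
        ≡⟨ cong₂ _+_ (cong (_* Q false) (satisfies-∷ʳ T cs (ws zero) false))
                     (cong (_* Q true) (satisfies-∷ʳ T cs (ws zero) true)) ⟨
      fixing false T + fixing true T ∎
      where
      Q : Bool → ℕ
      Q v = P (v ∷ᶠ (λ j → T ! ws (suc j)))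

    length-∷ʳ : ∀ c → length (cs ∷ʳ c) + m ≡ length cs + suc m
    length-∷ʳ c = trans (cong (_+ m) (length-++ cs)) (+-assoc (length cs) 1 m)

    keys-∷ʳ : ∀ c → keys (cs ∷ʳ c) ++ tabulate (ws ∘ suc) ≡ keys cs ++ proj₁ c ∷ tabulate (ws ∘ suc)
    keys-∷ʳ c = trans (cong (_++ tabulate (ws ∘ suc)) (map-++ proj₁ cs _)) (++-assoc (keys cs) _ _)

    induction : ∀ v → ∑ (allTables b) (fixing v) * 2 ^ (length cs + suc m)
                      ≡ 2 ^ 2 ^ b * ∑ (allInputs m) (λ y → P (v ∷ᶠ y))
    induction v = trans (cong (λ e → ∑ (allTables b) (fixing v) * 2 ^ e) (sym (length-∷ʳ (ws zero , v))))
      (∑-tables-uniform m (ws ∘ suc) (cs ∷ʳ (ws zero , v)) (λ y → P (v ∷ᶠ y))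
        (λ y≗y′ → ext λ { zero → refl ; (suc j) → y≗y′ j })
        (subst Unique (sym (keys-∷ʳ (ws zero , v))) unique))

  ∑-tables-distinct : ∀ m (ws : Fin m → Vec Bool b) (P : BitString m → ℕ) →
    Extensional P → Unique (tabulate ws) →
    ∑ (allTables b) (λ T → P (λ j → T ! ws j)) * 2 ^ m ≡ 2 ^ 2 ^ b * ∑ (allInputs m) P
  ∑-tables-distinct {b} m ws P ext unique =
    trans (cong (_* 2 ^ m) (∑-cong (allTables b) (λ T → sym (*-identityˡ _))))
          (∑-tables-uniform m ws [] P ext unique)

module Simulation where

  open import Defs
  open Sums
  open RandomTables
  open import Data.Bool using (Bool; true; false; if_then_else_)
  open import Data.Fin using (Fin; toℕ)
  open import Data.Fin.Properties using (toℕ-fromℕ<; toℕ-injective; toℕ<n)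
  open import Data.Nat using (ℕ; _+_; _*_; _%_; NonZero)
  open import Data.Nat.DivMod using (_mod_; %-distribˡ-+; m%n%n≡m%n; m<n⇒m%n≡m)
  open import Data.Nat.Properties using (+-assoc; +-comm)
  open import Data.Vec as Vec using (Vec; []; _∷_)
  open import Relation.Binary.PropositionalEquality

  module _ {n : ℕ} .{{_ : NonZero n}} where

    private variable
      b d m : ℕ

    _⊕_ : Fin n → ℕ → Fin n
    j ⊕ k = (toℕ j + k) mod n

    mod-cong : ∀ {a c} → a % n ≡ c % n → a mod n ≡ c mod n
    mod-cong {a} {c} eq = toℕ-injective (trans (toℕ-fromℕ< _) (trans eq (sym (toℕ-fromℕ< _))))

    mod-⊕ : ∀ a c → (a mod n) ⊕ c ≡ (a + c) mod n
    mod-⊕ a c = mod-cong (begin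
      (toℕ (a mod n) + c) % n       ≡⟨ cong (λ e → (e + c) % n) (toℕ-fromℕ< _) ⟩
      (a % n + c) % n               ≡⟨ %-distribˡ-+ (a % n) c n ⟩
      (a % n % n + c % n) % n       ≡⟨ cong (λ e → (e + c % n) % n) (m%n%n≡m%n a n) ⟩
      (a % n + c % n) % n           ≡⟨ %-distribˡ-+ a c n ⟨
      (a + c) % n                   ∎)
      where open ≡-Reasoning

    ⊕-toℕ-mod : ∀ v a → v ⊕ toℕ (a mod n) ≡ v ⊕ a
    ⊕-toℕ-mod v a = trans (cong (_mod n) (+-comm (toℕ v) _))
                          (trans (mod-⊕ a (toℕ v)) (cong (_mod n) (+-comm a (toℕ v))))

    ⊕-⊕ : ∀ j a c → (j ⊕ a) ⊕ c ≡ j ⊕ (a + c)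
    ⊕-⊕ j a c = trans (mod-⊕ (toℕ j + a) c) (cong (_mod n) (+-assoc (toℕ j) a c))

    toℕ-mod : (v : Fin n) → toℕ v mod n ≡ v
    toℕ-mod v = toℕ-injective (trans (toℕ-fromℕ< _) (m<n⇒m%n≡m (toℕ<n v)))

    positions : Vec (Fin n) b → Fin n → Vec (Fin n) b
    positions r j = Vec.map (λ u → j ⊕ toℕ u) r

    window : Vec (Fin n) b → BitString n → Fin n → Vec Bool b
    window r x j = Vec.map x (positions r j)

    derived : Vec (Fin n) b → Table b → BitString n → BitString n
    derived r T x j = T ! window r x j

    window-≪ : ∀ (r : Vec (Fin n) b) x j → window r (x ≪ 1) j ≡ window r x (j ⊕ 1)
    window-≪ []      x j = refl
    window-≪ (u ∷ r) x j = cong₂ _∷_ (cong x commute) (window-≪ r x j)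
      where
      commute : (j ⊕ toℕ u) ⊕ 1 ≡ (j ⊕ 1) ⊕ toℕ u
      commute = trans (⊕-⊕ j (toℕ u) 1) (trans (cong (j ⊕_) (+-comm (toℕ u) 1)) (sym (⊕-⊕ j 1 (toℕ u))))

    derived-≪ : ∀ (r : Vec (Fin n) b) T x j → derived r T (x ≪ 1) j ≡ (derived r T x ≪ 1) j
    derived-≪ r T x j = cong (T !_) (window-≪ r x j)

    queryAll : Vec (Fin n) b → (Vec Bool b → QTree n m) → QTree n (b + m)
    queryAll []       k = k []
    queryAll (p ∷ ps) k =
      query p (queryAll ps (λ w → k (false ∷ w))) (queryAll ps (λ w → k (true ∷ w)))

    eval-queryAll : ∀ (ps : Vec (Fin n) b) (k : Vec Bool b → QTree n m) x →
                    eval (queryAll ps k) x ≡ eval (k (Vec.map x ps)) x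
    eval-queryAll []       k x = refl
    eval-queryAll (p ∷ ps) k x with x p
    ... | false = eval-queryAll ps (λ w → k (false ∷ w)) x
    ... | true  = eval-queryAll ps (λ w → k (true ∷ w)) x

    simulate : Vec (Fin n) b → Table b → QTree n d → QTree n (d * b)
    simulate r T (leaf o)        = leaf o
    simulate r T (query j t₀ t₁) =
      queryAll (positions r j) (λ w → if T ! w then simulate r T t₁ else simulate r T t₀)

    eval-simulate : ∀ (r : Vec (Fin n) b) T (t : QTree n d) x →
                    eval (simulate r T t) x ≡ eval t (derived r T x)
    eval-simulate r T (leaf o)        x = refl
    eval-simulate r T (query j t₀ t₁) x = trans (eval-queryAll (positions r j) _ x) branch
      where
      branch : eval (if T ! window r x j then simulate r T t₁ else simulate r T t₀) x
               ≡ eval (query j t₀ t₁) (derived r T x)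
      branch with T ! window r x j
      ... | false = eval-simulate r T t₀ x
      ... | true  = eval-simulate r T t₁ x

    eval-cong : ∀ (t : QTree n d) {y y′ : BitString n} → (∀ j → y j ≡ y′ j) → eval t y ≡ eval t y′
    eval-cong (leaf o)        y≗y′ = refl
    eval-cong (query i t₀ t₁) {y} {y′} y≗y′ with y i | y′ i | y≗y′ i
    ... | false | .false | refl = eval-cong t₀ y≗y′
    ... | true  | .true  | refl = eval-cong t₁ y≗y′

    failure : QTree n d → BitString n → ℕ
    failure t y = 𝟙 (fails? (eval t) y)

    𝟙-fails-cong : ∀ (f g : BitString n → Fin n) {y z} → f y ≡ g z → f (y ≪ 1) ≡ g (z ≪ 1) →
                   𝟙 (fails? f y) ≡ 𝟙 (fails? g z)
    𝟙-fails-cong f g fy≡gz fy₁≡gz₁ = 𝟙-cong (fails? f _) (fails? g _)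
      (λ ¬okf okg → ¬okf (trans fy≡gz (trans okg (cong sucMod (sym fy₁≡gz₁)))))
      (λ ¬okg okf → ¬okg (trans (sym fy≡gz) (trans okf (cong sucMod fy₁≡gz₁))))

    failure-extensional : (t : QTree n d) → Extensional (failure t)
    failure-extensional t y≗y′ =
      𝟙-fails-cong (eval t) (eval t) (eval-cong t y≗y′) (eval-cong t (λ j → y≗y′ _))

    failure-simulate : ∀ (r : Vec (Fin n) b) T (t : QTree n d) x →
                       failure (simulate r T t) x ≡ failure t (derived r T x)
    failure-simulate r T t x = 𝟙-fails-cong (eval (simulate r T t)) (eval t) (eval-simulate r T t x)
      (trans (eval-simulate r T t (x ≪ 1)) (eval-cong t (derived-≪ r T x)))

module Collisions where

  open import Defs
  open Sums
  open RationalBounds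
  open RandomTables
  open Simulation
  open import Data.Bool using (Bool; true; false)
  open import Data.Bool.Properties renaming (_≟_ to _≟ᵇ_)
  open import Data.Empty using (⊥-elim)
  open import Data.Fin using (Fin; toℕ; zero; suc)
  open import Data.Fin.Properties using (toℕ<n) renaming (_≟_ to _≟ᶠ_)
  open import Data.List using (List; []; _∷_; length; tabulate; allFin; cartesianProductWith)
  open import Data.List.Properties using (length-tabulate)
  open import Data.List.Membership.Propositional.Properties using (∈-allFin)
  open import Data.List.Relation.Unary.Unique.Propositional using (Unique)
  open import Data.List.Relation.Unary.Unique.Propositional.Properties using (tabulate⁺)
  open import Data.Nat as ℕ using (ℕ; zero; suc; _+_; _*_; _∸_; _^_; _%_; _<_; NonZero)
  open import Data.Nat.DivMod using (_mod_; [m+n]%n≡m%n)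
  open import Data.Nat.Properties as ℕ using (m+[n∸m]≡n; <⇒≤; n≢0⇒n>0)
  open import Data.Nat.Tactic.RingSolver using (solve-∀)
  open import Algebra.Properties.CommutativeSemigroup ℕ.+-commutativeSemigroup using (x∙yz≈y∙xz)
  open import Data.Rational using (ℚ; _-_; _≤_; 0ℚ; 1ℚ) renaming (_*_ to _*ℚ_)
  open import Data.Rational.Properties using (module ≤-Reasoning)
  open import Data.Vec using (Vec; []; _∷_)
  open import Function using (_∘_; const)
  open import Relation.Nullary using (Dec; yes; no; ¬?)
  open import Relation.Binary.PropositionalEquality

  module _ {n : ℕ} .{{_ : NonZero n}} where

    private variable
      b : ℕ

    ∑-rotate : ∀ (F : Fin n → ℕ) c → ∑ (allFin n) (λ u → F (u ⊕ c)) ≡ ∑ (allFin n) F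
    ∑-rotate F c = begin
      ∑ (allFin n) (λ u → F (u ⊕ c))   ≡⟨ ∑-allFin-toℕ n (λ k → h (k + c)) ⟩
      ∑< n (λ k → h (k + c))           ≡⟨ ∑<-rotate n h (λ k → cong F (mod-cong ([m+n]%n≡m%n k n))) c ⟩
      ∑< n h                           ≡⟨ ∑-allFin-toℕ n h ⟨
      ∑ (allFin n) (h ∘ toℕ)           ≡⟨ ∑-cong (allFin n) (λ v → cong F (toℕ-mod v)) ⟩
      ∑ (allFin n) F                   ∎
      where
      open ≡-Reasoning
      h : ℕ → ℕ
      h k = F (k mod n)

    agree : Vec Bool b → Vec Bool b → ℕ
    agree []      []        = 1
    agree (a ∷ w) (a′ ∷ w′) = 𝟙 (a ≟ᵇ a′) * agree w w′

    agree-refl : (w : Vec Bool b) → agree w w ≡ 1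
    agree-refl []          = refl
    agree-refl (false ∷ w) = trans (ℕ.+-identityʳ _) (agree-refl w)
    agree-refl (true  ∷ w) = trans (ℕ.+-identityʳ _) (agree-refl w)

    collisions : Vec (Fin n) b → BitString n → ℕ
    collisions r x =
      ∑ (allFin n) λ j → ∑ (allFin n) λ j′ → 𝟙 (¬? (j ≟ᶠ j′)) * agree (window r x j) (window r x j′)

    collisions≡0⇒unique : ∀ (r : Vec (Fin n) b) x → collisions r x ≡ 0 → Unique (tabulate (window r x))
    collisions≡0⇒unique r x none = tabulate⁺ injective
      where
      injective : ∀ {j j′} → window r x j ≡ window r x j′ → j ≡ j′
      injective {j} {j′} same with j ≟ᶠ j′ in eq
      ... | yes j≡j′ = j≡j′
      ... | no  _    =
        ⊥-elim (ℕ.1+n≢0 (trans (sym collide) (∑≡0⇒≡0 _ (∑≡0⇒≡0 _ none (∈-allFin j)) (∈-allFin j′))))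
        where
        open ≡-Reasoning
        collide : 𝟙 (¬? (j ≟ᶠ j′)) * agree (window r x j) (window r x j′) ≡ 1
        collide = begin
          𝟙 (¬? (j ≟ᶠ j′)) * agree (window r x j) (window r x j′)
            ≡⟨ cong₂ (λ d w → 𝟙 (¬? d) * agree (window r x j) w) eq (sym same) ⟩
          1 * agree (window r x j) (window r x j)
            ≡⟨ trans (ℕ.*-identityˡ _) (agree-refl (window r x j)) ⟩
          1 ∎

    allOffsets : ∀ b → List (Vec (Fin n) b)
    allOffsets zero    = [] ∷ []
    allOffsets (suc b) = cartesianProductWith _∷_ (allFin n) (allOffsets b)

    ∏ : (Fin n → ℕ) → Vec (Fin n) b → ℕ
    ∏ g []      = 1
    ∏ g (u ∷ r) = g u * ∏ g r

    ∑-∏ : ∀ b (g : Fin n → ℕ) → ∑ (allOffsets b) (∏ g) ≡ ∑ (allFin n) g ^ b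
    ∑-∏ zero    g = refl
    ∑-∏ (suc b) g = begin
      ∑ (cartesianProductWith _∷_ (allFin n) (allOffsets b)) (∏ g)
        ≡⟨ ∑-cartesianProductWith _∷_ (allFin n) (allOffsets b) (∏ g) ⟩
      ∑ (allFin n) (λ u → ∑ (allOffsets b) (λ r → g u * ∏ g r))
        ≡⟨ ∑-cong (allFin n) (λ u → ∑-*ˡ (allOffsets b) (g u) (∏ g)) ⟩
      ∑ (allFin n) (λ u → g u * ∑ (allOffsets b) (∏ g))           ≡⟨ ∑-*ʳ (allFin n) _ g ⟩
      ∑ (allFin n) g * ∑ (allOffsets b) (∏ g)                     ≡⟨ cong (∑ (allFin n) g *_) (∑-∏ b g) ⟩
      ∑ (allFin n) g * ∑ (allFin n) g ^ b                         ∎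
      where open ≡-Reasoning

    ∑-allFin-1 : ∑ (allFin n) (const 1) ≡ n
    ∑-allFin-1 = trans (sym (length≡∑1 (allFin n))) (length-tabulate (λ i → i))

    length-allOffsets : ∀ b → length (allOffsets b) ≡ n ^ b
    length-allOffsets b = begin
      length (allOffsets b)             ≡⟨ length≡∑1 (allOffsets b) ⟩
      ∑ (allOffsets b) (const 1)        ≡⟨ ∑-cong (allOffsets b) (λ r → sym (∏-1 r)) ⟩
      ∑ (allOffsets b) (∏ (const 1))    ≡⟨ ∑-∏ b (const 1) ⟩
      ∑ (allFin n) (const 1) ^ b        ≡⟨ cong (_^ b) ∑-allFin-1 ⟩
      n ^ b                             ∎
      where
      open ≡-Reasoning
      ∏-1 : ∀ {b} (r : Vec (Fin n) b) → ∏ (const 1) r ≡ 1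
      ∏-1 []      = refl
      ∏-1 (u ∷ r) = trans (ℕ.+-identityʳ _) (∏-1 r)

    agreements : BitString n → Fin n → Fin n → ℕ
    agreements x j j′ = ∑ (allFin n) (λ u → 𝟙 (x (j ⊕ toℕ u) ≟ᵇ x (j′ ⊕ toℕ u)))

    agree-window : ∀ (r : Vec (Fin n) b) x j j′ →
                   agree (window r x j) (window r x j′) ≡ ∏ (λ u → 𝟙 (x (j ⊕ toℕ u) ≟ᵇ x (j′ ⊕ toℕ u))) r
    agree-window []      x j j′ = refl
    agree-window (u ∷ r) x j j′ = cong (𝟙 (x (j ⊕ toℕ u) ≟ᵇ x (j′ ⊕ toℕ u)) *_) (agree-window r x j j′)

    ∑-collisions : ∀ b x → ∑ (allOffsets b) (λ r → collisions r x)
                   ≡ ∑ (allFin n) λ j → ∑ (allFin n) λ j′ → 𝟙 (¬? (j ≟ᶠ j′)) * agreements x j j′ ^ b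
    ∑-collisions b x =
      trans (∑-comm (allOffsets b) (allFin n) _) (∑-cong (allFin n) λ j →
      trans (∑-comm (allOffsets b) (allFin n) _) (∑-cong (allFin n) λ j′ →
      trans (∑-*ˡ (allOffsets b) (𝟙 (¬? (j ≟ᶠ j′))) _) (cong (𝟙 (¬? (j ≟ᶠ j′)) *_)
      (trans (∑-cong (allOffsets b) (λ r → agree-window r x j j′)) (∑-∏ b _)))))

    gap : Fin n → Fin n → Fin n
    gap j j′ = j′ ⊕ (n ∸ toℕ j)

    j+[n∸j]≡n : (j : Fin n) → toℕ j + (n ∸ toℕ j) ≡ n
    j+[n∸j]≡n j = m+[n∸m]≡n (<⇒≤ (toℕ<n j))

    ⊕-gap : ∀ j j′ → j ⊕ toℕ (gap j j′) ≡ j′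
    ⊕-gap j j′ = trans (⊕-toℕ-mod j (toℕ j′ + (n ∸ toℕ j))) (trans (mod-cong (begin
      (toℕ j + (toℕ j′ + (n ∸ toℕ j))) % n    ≡⟨ cong (_% n) (x∙yz≈y∙xz (toℕ j) (toℕ j′) _) ⟩
      (toℕ j′ + (toℕ j + (n ∸ toℕ j))) % n    ≡⟨ cong (λ e → (toℕ j′ + e) % n) (j+[n∸j]≡n j) ⟩
      (toℕ j′ + n) % n                         ≡⟨ [m+n]%n≡m%n (toℕ j′) n ⟩
      toℕ j′ % n                               ∎)) (toℕ-mod j′))
      where open ≡-Reasoning

    gap-pos : ∀ {j j′} → j ≢ j′ → 0 < toℕ (gap j j′)
    gap-pos {j} {j′} j≢j′ = n≢0⇒n>0 λ gap≡0 → j≢j′ (begin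
      j                        ≡⟨ toℕ-mod j ⟨
      toℕ j mod n              ≡⟨ cong (_mod n) (ℕ.+-identityʳ (toℕ j)) ⟨
      (toℕ j + 0) mod n        ≡⟨ cong (λ k → (toℕ j + k) mod n) gap≡0 ⟨
      j ⊕ toℕ (gap j j′)       ≡⟨ ⊕-gap j j′ ⟩
      j′                       ∎)
      where open ≡-Reasoning

    agreements-≪ : ∀ x i j j′ →
                   agreements (x ≪ i) j j′ ≡ ∑ (allFin n) (λ v → 𝟙 (x v ≟ᵇ x (v ⊕ toℕ (gap j j′))))
    agreements-≪ x i j j′ =
      trans (∑-cong (allFin n) (λ u → cong₂ (λ p q → 𝟙 (x p ≟ᵇ x q)) (lhs u) (rhs u)))
            (∑-rotate (λ v → 𝟙 (x v ≟ᵇ x (v ⊕ toℕ (gap j j′)))) (toℕ j + i))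
      where
      open ≡-Reasoning
      lhs : ∀ u → (j ⊕ toℕ u) ⊕ i ≡ u ⊕ (toℕ j + i)
      lhs u = trans (⊕-⊕ j (toℕ u) i) (cong (_mod n) (rearrange (toℕ j) (toℕ u) i))
        where
        rearrange : ∀ a b c → a + (b + c) ≡ b + (a + c)
        rearrange = solve-∀
      rhs : ∀ u → (j′ ⊕ toℕ u) ⊕ i ≡ (u ⊕ (toℕ j + i)) ⊕ toℕ (gap j j′)
      rhs u = sym (begin
        (u ⊕ (toℕ j + i)) ⊕ toℕ (gap j j′)
          ≡⟨ ⊕-toℕ-mod (u ⊕ (toℕ j + i)) _ ⟩
        (u ⊕ (toℕ j + i)) ⊕ (toℕ j′ + (n ∸ toℕ j))
          ≡⟨ ⊕-⊕ u (toℕ j + i) _ ⟩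
        u ⊕ (toℕ j + i + (toℕ j′ + (n ∸ toℕ j)))
          ≡⟨ cong (_mod n) (rearrange (toℕ u) (toℕ j) i (toℕ j′) _) ⟩
        (toℕ j′ + (toℕ u + i) + (toℕ j + (n ∸ toℕ j))) mod n
          ≡⟨ cong (λ e → (toℕ j′ + (toℕ u + i) + e) mod n) (j+[n∸j]≡n j) ⟩
        (toℕ j′ + (toℕ u + i) + n) mod n
          ≡⟨ mod-cong ([m+n]%n≡m%n (toℕ j′ + (toℕ u + i)) n) ⟩
        j′ ⊕ (toℕ u + i)
          ≡⟨ ⊕-⊕ j′ (toℕ u) i ⟨
        (j′ ⊕ toℕ u) ⊕ i ∎)
        where
        rearrange : ∀ u j i j′ e → u + (j + i + (j′ + e)) ≡ j′ + (u + i) + (j + e)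
        rearrange = solve-∀

    agreements+hamming : ∀ x i j j′ → agreements (x ≪ i) j j′ + hamming (x ≪ toℕ (gap j j′)) x ≡ n
    agreements+hamming x i j j′ = begin
      agreements (x ≪ i) j j′ + hamming (x ≪ k) x
        ≡⟨ cong₂ _+_ (agreements-≪ x i j j′) (length-filter≡∑𝟙 (λ v → ¬? (x (v ⊕ k) ≟ᵇ x v)) (allFin n)) ⟩
      ∑ (allFin n) (λ v → 𝟙 (x v ≟ᵇ x (v ⊕ k))) + ∑ (allFin n) (λ v → 𝟙 (¬? (x (v ⊕ k) ≟ᵇ x v)))
        ≡⟨ ∑-distrib-+ (allFin n) _ _ ⟨
      ∑ (allFin n) (λ v → 𝟙 (x v ≟ᵇ x (v ⊕ k)) + 𝟙 (¬? (x (v ⊕ k) ≟ᵇ x v)))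
        ≡⟨ ∑-cong (allFin n) complementary ⟩
      ∑ (allFin n) (const 1)
        ≡⟨ ∑-allFin-1 ⟩
      n ∎
      where
      open ≡-Reasoning
      k : ℕ
      k = toℕ (gap j j′)
      complementary : ∀ v → 𝟙 (x v ≟ᵇ x (v ⊕ k)) + 𝟙 (¬? (x (v ⊕ k) ≟ᵇ x v)) ≡ 1
      complementary v =
        trans (cong (_+ 𝟙 (¬? (x (v ⊕ k) ≟ᵇ x v))) (𝟙-cong (x v ≟ᵇ x (v ⊕ k)) (x (v ⊕ k) ≟ᵇ x v) sym sym))
              (𝟙+𝟙¬≡1 (x (v ⊕ k) ≟ᵇ x v))

    agreements≤ : ∀ {α} x i {j j′} → Good n α x → j ≢ j′ →
                  ℕ→ℚ (agreements (x ≪ i) j j′) ≤ (1ℚ - α) *ℚ ℕ→ℚ n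
    agreements≤ {α} x i {j} {j′} good j≢j′ =
      m+n≡k⇒αk≤n⇒m≤[1-α]k (agreements (x ≪ i) j j′) (hamming (x ≪ toℕ (gap j j′)) x) n α
        (agreements+hamming x i j j′) (good _ (gap-pos j≢j′) (toℕ<n (gap j j′)))

    ∑-collisions-≤ : ∀ {α} b x i → α ≤ 1ℚ → Good n α x →
      ℕ→ℚ (∑ (allOffsets b) (λ r → collisions r (x ≪ i))) ≤ ℕ→ℚ n *ℚ (ℕ→ℚ n *ℚ ((1ℚ - α) *ℚ ℕ→ℚ n) ^ℚ b)
    ∑-collisions-≤ {α} b x i α≤1 good =
      subst₂ (λ s l → ℕ→ℚ s ≤ ℕ→ℚ l *ℚ (ℕ→ℚ l *ℚ B))
             (sym (∑-collisions b (x ≪ i))) (length-tabulate {n = n} (λ i → i))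
        (ℕ→ℚ-∑-≤ (allFin n) (λ j → ∑ (allFin n) (λ j′ → summand j j′)) (λ j →
          ℕ→ℚ-∑-≤ (allFin n) (summand j) (λ j′ → term j j′ (j ≟ᶠ j′))))
      where
      B : ℚ
      B = ((1ℚ - α) *ℚ ℕ→ℚ n) ^ℚ b
      summand : Fin n → Fin n → ℕ
      summand j j′ = 𝟙 (¬? (j ≟ᶠ j′)) * agreements (x ≪ i) j j′ ^ b
      0≤B : 0ℚ ≤ B
      0≤B = 0≤^ℚ b (0≤* (p≤q⇒0≤q-p α≤1) (0≤ℕ→ℚ n))
      term : ∀ j j′ (j≟j′ : Dec (j ≡ j′)) → ℕ→ℚ (𝟙 (¬? j≟j′) * agreements (x ≪ i) j j′ ^ b) ≤ B
      term j j′ (yes _)    = 0≤B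
      term j j′ (no j≢j′) = begin
        ℕ→ℚ (1 * A ^ b)   ≡⟨ cong ℕ→ℚ (ℕ.*-identityˡ (A ^ b)) ⟩
        ℕ→ℚ (A ^ b)       ≡⟨ ℕ→ℚ-^ A b ⟩
        ℕ→ℚ A ^ℚ b        ≤⟨ ^ℚ-mono-≤ b (0≤ℕ→ℚ A) (agreements≤ {α} x i good j≢j′) ⟩
        B                 ∎
        where
        open ≤-Reasoning
        A : ℕ
        A = agreements (x ≪ i) j j′

module WorstCase where

  open import Defs
  open Sums
  open RationalBounds
  open RandomTables
  open Simulation
  open Collisions
  open import Data.Fin using (Fin)
  open import Data.List using (List; length; filter; allFin; lookup; cartesianProduct)
  open import Data.Nat as ℕ using (ℕ; zero; suc; NonZero; _^_)
  import Data.Nat.Properties as ℕ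
  open import Data.Product using (_×_; _,_; uncurry)
  open import Data.Rational using (ℚ; _+_; _*_; _-_; _≤_; 1ℚ)
  open import Data.Rational.Properties using (*-cancelʳ-≤-pos; +-mono-≤; module ≤-Reasoning)
  open import Data.Rational.Solver using (module +-*-Solver)
  open import Data.Vec using (Vec)
  open import Relation.Binary.PropositionalEquality

  failure-rate-≤ : ∀ F N K E C n b .{{_ : NonZero N}} δ β →
    F ℕ.* N ℕ.≤ n ^ b ℕ.* (K ℕ.* E) ℕ.+ N ℕ.* K ℕ.* C →
    ℕ→ℚ E ≤ δ * ℕ→ℚ N →
    ℕ→ℚ C ≤ ℕ→ℚ n * (ℕ→ℚ n * (β * ℕ→ℚ n) ^ℚ b) →
    ℕ→ℚ F ≤ (δ + ℕ→ℚ (n ℕ.* n) * β ^ℚ b) * ℕ→ℚ (n ^ b ℕ.* K)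
  failure-rate-≤ F N K E C n b δ β FN≤ E≤ C≤ = *-cancelʳ-≤-pos (ℕ→ℚ N) {{ℕ→ℚ-pos N}} (begin
    ℕ→ℚ F * ℕ→ℚ N                                      ≡⟨ ℕ→ℚ-* F N ⟨
    ℕ→ℚ (F ℕ.* N)                                      ≤⟨ ℕ→ℚ-mono-≤ FN≤ ⟩
    ℕ→ℚ (n ^ b ℕ.* (K ℕ.* E) ℕ.+ N ℕ.* K ℕ.* C)
      ≡⟨ trans (ℕ→ℚ-+ (n ^ b ℕ.* (K ℕ.* E)) _) (cong₂ _+_
           (trans (ℕ→ℚ-* (n ^ b) _) (cong₂ _*_ (ℕ→ℚ-^ n b) (ℕ→ℚ-* K E)))
           (trans (ℕ→ℚ-* (N ℕ.* K) C) (cong (_* ℕ→ℚ C) (ℕ→ℚ-* N K)))) ⟩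
    nᵇ * (k * ℕ→ℚ E) + ν * k * ℕ→ℚ C
      ≤⟨ +-mono-≤ (*-monoˡ-≤-0≤ (0≤^ℚ b (0≤ℕ→ℚ n)) (*-monoˡ-≤-0≤ (0≤ℕ→ℚ K) E≤))
                  (*-monoˡ-≤-0≤ (0≤* (0≤ℕ→ℚ N) (0≤ℕ→ℚ K)) C≤) ⟩
    nᵇ * (k * (δ * ν)) + ν * k * (m * (m * (β * m) ^ℚ b))
      ≡⟨ cong (λ e → nᵇ * (k * (δ * ν)) + ν * k * (m * (m * e))) (^ℚ-distrib-* β m b) ⟩
    nᵇ * (k * (δ * ν)) + ν * k * (m * (m * (β ^ℚ b * nᵇ)))
      ≡⟨ solve 6 (λ nᵇ k δ ν m βᵇ → nᵇ :* (k :* (δ :* ν)) :+ ν :* k :* (m :* (m :* (βᵇ :* nᵇ)))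
                                 := (δ :+ m :* m :* βᵇ) :* (nᵇ :* k) :* ν) refl nᵇ k δ ν m (β ^ℚ b) ⟩
    (δ + m * m * β ^ℚ b) * (nᵇ * k) * ν
      ≡⟨ cong₂ (λ p q → (δ + p * β ^ℚ b) * q * ν) (ℕ→ℚ-* n n)
               (trans (ℕ→ℚ-* (n ^ b) K) (cong (_* k) (ℕ→ℚ-^ n b))) ⟨
    (δ + ℕ→ℚ (n ℕ.* n) * β ^ℚ b) * ℕ→ℚ (n ^ b ℕ.* K) * ℕ→ℚ N ∎)
    where
    open ≤-Reasoning
    open +-*-Solver
    m : ℚ
    m = ℕ→ℚ n
    nᵇ : ℚ
    nᵇ = ℕ→ℚ n ^ℚ b
    k : ℚ
    k = ℕ→ℚ K
    ν : ℚ
    ν = ℕ→ℚ N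

  module _ {n : ℕ} .{{_ : NonZero n}} where

    -- Without collisions the derived input is uniform over T; otherwise each failure counts at most 1.
    ∑-tables-failure-≤ : ∀ {b d} (r : Vec (Fin n) b) (t : QTree n d) x →
      ∑ (allTables b) (λ T → failure t (derived r T x)) ℕ.* 2 ^ n
        ℕ.≤ 2 ^ 2 ^ b ℕ.* ∑ (allInputs n) (failure t) ℕ.+ 2 ^ n ℕ.* 2 ^ 2 ^ b ℕ.* collisions r x
    ∑-tables-failure-≤ {b} r t x with collisions r x in none
    ... | zero  = ℕ.≤-trans (ℕ.≤-reflexive (∑-tables-distinct n (window r x) (failure t) (failure-extensional t)
                                                               (collisions≡0⇒unique r x none)))
                            (ℕ.m≤m+n _ _)
    ... | suc c = ℕ.≤-trans crude (ℕ.m≤n+m _ _)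
      where
      open ℕ.≤-Reasoning
      crude : ∑ (allTables b) (λ T → failure t (derived r T x)) ℕ.* 2 ^ n ℕ.≤ 2 ^ n ℕ.* 2 ^ 2 ^ b ℕ.* suc c
      crude = begin
        ∑ (allTables b) (λ T → failure t (derived r T x)) ℕ.* 2 ^ n
          ≤⟨ ℕ.*-monoˡ-≤ (2 ^ n)
               (ℕ.≤-trans (∑-mono-≤ (allTables b) (λ T → 𝟙≤1 (fails? (eval t) (derived r T x))))
                          (ℕ.≤-reflexive (sym (length≡∑1 (allTables b))))) ⟩
        length (allTables b) ℕ.* 2 ^ n     ≡⟨ cong (ℕ._* 2 ^ n) (length-allTables b) ⟩
        2 ^ 2 ^ b ℕ.* 2 ^ n                ≡⟨ trans (ℕ.*-comm (2 ^ 2 ^ b) (2 ^ n)) (sym (ℕ.*-identityʳ _)) ⟩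
        2 ^ n ℕ.* 2 ^ 2 ^ b ℕ.* 1          ≤⟨ ℕ.*-monoʳ-≤ (2 ^ n ℕ.* 2 ^ 2 ^ b) (ℕ.s≤s ℕ.z≤n) ⟩
        2 ^ n ℕ.* 2 ^ 2 ^ b ℕ.* suc c      ∎

    seeds : ∀ b → List (Vec (Fin n) b × Table b)
    seeds b = cartesianProduct (allOffsets b) (allTables b)

    length-seeds : ∀ b → length (seeds b) ≡ n ^ b ℕ.* 2 ^ 2 ^ b
    length-seeds b = begin
      length (seeds b)
        ≡⟨ length≡∑1 (seeds b) ⟩
      ∑ (seeds b) (λ _ → 1)
        ≡⟨ ∑-cartesianProduct (allOffsets b) (allTables b) (λ _ → 1) (λ _ → 1) ⟩
      ∑ (allOffsets b) (λ _ → 1) ℕ.* ∑ (allTables b) (λ _ → 1)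
        ≡⟨ cong₂ ℕ._*_ (length≡∑1 (allOffsets b)) (length≡∑1 (allTables b)) ⟨
      length (allOffsets b) ℕ.* length (allTables b)
        ≡⟨ cong₂ ℕ._*_ (length-allOffsets b) (length-allTables b) ⟩
      n ^ b ℕ.* 2 ^ 2 ^ b ∎
      where open ≡-Reasoning

    family : ∀ {d} b → QTree n d → Family n (d ℕ.* b) (length (seeds b))
    family b t s = uncurry (λ r T → simulate r T t) (lookup (seeds b) s)

    failures-family : ∀ {d} b (t : QTree n d) x →
      length (filter (λ s → fails? (eval (family b t s)) x) (allFin (length (seeds b))))
        ≡ ∑ (allOffsets b) (λ r → ∑ (allTables b) (λ T → failure t (derived r T x)))
    failures-family b t x = begin
      length (filter (λ s → fails? (eval (family b t s)) x) (allFin (length (seeds b))))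
        ≡⟨ length-filter≡∑𝟙 (λ s → fails? (eval (family b t s)) x) (allFin (length (seeds b))) ⟩
      ∑ (allFin (length (seeds b))) (λ s → failure (family b t s) x)
        ≡⟨ ∑-lookup (seeds b) (uncurry λ r T → failure (simulate r T t) x) ⟩
      ∑ (seeds b) (uncurry λ r T → failure (simulate r T t) x)
        ≡⟨ ∑-cartesianProductWith _,_ (allOffsets b) (allTables b) _ ⟩
      ∑ (allOffsets b) (λ r → ∑ (allTables b) (λ T → failure (simulate r T t) x))
        ≡⟨ ∑-cong (allOffsets b) (λ r → ∑-cong (allTables b) (λ T → failure-simulate r T t x)) ⟩
      ∑ (allOffsets b) (λ r → ∑ (allTables b) (λ T → failure t (derived r T x))) ∎
      where open ≡-Reasoning

    failures-family-≤ : ∀ {d} b (t : QTree n d) x →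
      ∑ (allOffsets b) (λ r → ∑ (allTables b) (λ T → failure t (derived r T x))) ℕ.* 2 ^ n
        ℕ.≤ n ^ b ℕ.* (2 ^ 2 ^ b ℕ.* ∑ (allInputs n) (failure t))
            ℕ.+ 2 ^ n ℕ.* 2 ^ 2 ^ b ℕ.* ∑ (allOffsets b) (λ r → collisions r x)
    failures-family-≤ b t x = begin
      ∑ (allOffsets b) (λ r → ∑ (allTables b) (λ T → failure t (derived r T x))) ℕ.* 2 ^ n
        ≡⟨ ∑-*ʳ (allOffsets b) (2 ^ n) _ ⟨
      ∑ (allOffsets b) (λ r → ∑ (allTables b) (λ T → failure t (derived r T x)) ℕ.* 2 ^ n)
        ≤⟨ ∑-mono-≤ (allOffsets b) (λ r → ∑-tables-failure-≤ r t x) ⟩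
      ∑ (allOffsets b) (λ r → K ℕ.* E ℕ.+ 2 ^ n ℕ.* K ℕ.* collisions r x)
        ≡⟨ ∑-distrib-+ (allOffsets b) _ _ ⟩
      ∑ (allOffsets b) (λ _ → K ℕ.* E) ℕ.+ ∑ (allOffsets b) (λ r → 2 ^ n ℕ.* K ℕ.* collisions r x)
        ≡⟨ cong₂ ℕ._+_ (trans (∑-const (allOffsets b) (K ℕ.* E)) (cong (ℕ._* (K ℕ.* E)) (length-allOffsets b)))
                       (∑-*ˡ (allOffsets b) (2 ^ n ℕ.* K) _) ⟩
      n ^ b ℕ.* (K ℕ.* E) ℕ.+ 2 ^ n ℕ.* K ℕ.* ∑ (allOffsets b) (λ r → collisions r x) ∎
      where
      open ℕ.≤-Reasoning
      K : ℕ
      K = 2 ^ 2 ^ b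
      E : ℕ
      E = ∑ (allInputs n) (failure t)

    random⇒worstCase : ∀ {d δ α} b → RandomLPHS n d δ → α ≤ 1ℚ →
                       WorstCaseLPHS n (d ℕ.* b) (δ + ℕ→ℚ (n ℕ.* n) * (1ℚ - α) ^ℚ b) (Good n α)
    random⇒worstCase {d} {δ} {α} b (t , random) α≤1 = length (seeds b) , nonZero , family b t , bound
      where
      nonZero : NonZero (length (seeds b))
      nonZero = subst NonZero (sym (length-seeds b))
                      (ℕ.m*n≢0 (n ^ b) (2 ^ 2 ^ b) {{ℕ.m^n≢0 n b}} {{ℕ.m^n≢0 2 (2 ^ b)}})
      bound : IsWorstCaseLPHS n (d ℕ.* b) (length (seeds b)) {{nz = nonZero}} _ (Good n α) (family b t)
      bound .(x ≪ i) (x , i , good , _ , refl) = count≤⇒prob≤ F (length (seeds b)) {{nonZero}} F≤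
        where
        F : ℕ
        F = length (filter (λ s → fails? (eval (family b t s)) (x ≪ i)) (allFin (length (seeds b))))
        S : ℕ
        S = ∑ (allOffsets b) (λ r → ∑ (allTables b) (λ T → failure t (derived r T (x ≪ i))))
        C : ℕ
        C = ∑ (allOffsets b) (λ r → collisions r (x ≪ i))
        E : ℕ
        E = ∑ (allInputs n) (failure t)
        ε : ℚ
        ε = δ + ℕ→ℚ (n ℕ.* n) * (1ℚ - α) ^ℚ b
        E≤ : ℕ→ℚ E ≤ δ * ℕ→ℚ (2 ^ n)
        E≤ = subst (λ e → ℕ→ℚ e ≤ δ * ℕ→ℚ (2 ^ n)) (length-filter≡∑𝟙 (fails? (eval t)) (allInputs n))
               (prob≤⇒count≤ (length (filter (fails? (eval t)) (allInputs n))) (2 ^ n) {{ℕ.m^n≢0 2 n}} random)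
        F≤ : ℕ→ℚ F ≤ ε * ℕ→ℚ (length (seeds b))
        F≤ = subst₂ (λ f k → ℕ→ℚ f ≤ ε * ℕ→ℚ k) (sym (failures-family b t (x ≪ i))) (sym (length-seeds b))
               (failure-rate-≤ S (2 ^ n) (2 ^ 2 ^ b) E C n b {{ℕ.m^n≢0 2 n}} δ (1ℚ - α)
                  (failures-family-≤ b t (x ≪ i)) E≤ (∑-collisions-≤ b x i α≤1 good))

open import Defs
open import Data.Nat as ℕ using (ℕ; NonZero)
open import Data.Nat.Properties using (≤-reflexive; *-identityˡ)
open import Data.Rational using (ℚ; _+_; _*_; _-_; _≤_; _<_; 0ℚ; 1ℚ)
open import Data.Product using (_×_; ∃-syntax; _,_; proj₂)
open import Relation.Binary.PropositionalEquality using (cong; sym)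
open WorstCase using (random⇒worstCase)

-- The bound holds for every b.
proposition1 : (d : ℕ → ℕ) (δ : ℕ → ℚ) →
               (∀ n → .{{_ : NonZero n}} → RandomLPHS n (d n) (δ n)) →
               (α : ℕ → ℚ) → (∀ n → (0ℚ < α n) × (α n ≤ 1ℚ)) →
               (b : ℕ → ℕ) → SuperLogarithmic b →
               ∃[ C ] ∃[ N ] (∀ n → .{{_ : NonZero n}} → N ℕ.≤ n →
                 ∃[ d′ ] ((d′ ℕ.≤ C ℕ.* d n ℕ.* b n) ×
                   WorstCaseLPHS n d′
                     (δ n + ℕ→ℚ (n ℕ.* n) * ((1ℚ - α n) ^ℚ b n))
                     (Good n (α n))))
proposition1 d δ random α α-bounds b _ =
  1 , 1 , λ n _ → d n ℕ.* b n , ≤-reflexive (cong (ℕ._* b n) (sym (*-identityˡ (d n)))) ,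
                  random⇒worstCase (b n) (random n) (proj₂ (α-bounds n))
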